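{- Let $(C_0, I, O)$ be an ILP Modulo $T$ instance and consider the $\mathrm{BC}(T)$ transition system for it. For any states $\langle P, A\rangle$ and $\langle P', A'\rangle$ with $\langle P, A\rangle \longrightarrow \langle P', A'\rangle$, $$\bigvee_{\langle C,D\rangle \in P'} (C \wedge D) \;\models_{\mathcal Z}\; \bigvee_{\langle C,D\rangle \in P} (C \wedge D).$$
   Context: Fix a set $\mathcal V$ of integer variables. An integer linear constraint has the form $c_1v_1+\dots+c_nv_n \bowtie r$ with integers $c_i, r$, $v_i \in \mathcal V$, $\bowtie \in \{<,\le,=,>,\ge\}$; an integer linear formula is a finite set (conjunction) of such constraints; an empty disjunction is false. An integer assignment is a function $A:\mathcal V\to\mathbb Z$, identified with the set of formulas $\{v = A(v) : v\in\mathcal V\}$. $\mathcal Z$ denotes the theory of linear integer arithmetic (all first-order sentences over the signature $0,\pm1,\pm2,\dots,+,-,\le$ true in the standard model $\mathbb Z$). For a theory $T'$, a formula $F$ is $T'$-consistent if $F\wedge T'$ has a model, and $F\models_{T'} G$ means $F\wedge\neg G$ is $T'$-inconsistent. Let $T$ be a $\Sigma$-theory with $\Sigma$ disjoint from the signature of $\mathcal Z$. A $\Sigma$-interface atom is a $\Sigma$-atomic formula $t$, possibly annotated with a variable $v$ (written $t^v$), the annotation meaning $t \Leftrightarrow v>0$. An ILP Modulo $T$ instance is a triple $(C_0, I, O)$ with $C_0$ an integer linear formula, $I$ a set of $\Sigma$-interface atoms, and $O=\sum_i c_i v_i$ an integer linear expression to be minimized. For an assignment $A$, $obj(A)=\sum_i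 c_iA(v_i)$; also $obj(\mathrm{none})=+\infty$ and $obj(A^{ -\infty})=-\infty$. An assignment $A$ is a $T$-model of a formula $F$ if $A$ is $T$-consistent and $A\models_{\mathcal Z\cup T} F$. A simple equality is a constraint $v_i=c$ or $v_i-v_j=c$ ($c$ an integer constant). A subproblem is a pair $\langle C, D\rangle$ with $C$ a set of integer linear constraints and $D$ a set of simple equalities. A state is a pair $\langle P, A\rangle$ where $P$ is a set of subproblems and $A$ is either the constant $\mathrm{none}$, an assignment, or an assignment annotated with superscript $-\infty$. A fixed function $lb$ on subproblems satisfies: no assignment $A$ satisfying $C\wedge D$ has $obj(A) < lb(\langle C,D\rangle)$. Notation: $P\uplus Q$ is union of disjoint sets; $C\,c$ is $C\cup\{c\}$ with $c\notin C$ (likewise $D\,d$). The transition relation $\longrightarrow$ of $\mathrm{BC}(T)$ is given by the rules: Branch: $\langle P\uplus\{\langle C,D\rangle\}, A\rangle \longrightarrow \langle P\cup\{\langle C_i,D\rangle : 1\le i\le n\}, A\rangle$ if $n>1$, $D\models_{\mathcal Z}(C\Leftrightarrow\bigvee_{i} C_i)$, and the $C_i$ are syntactically distinct. Learn: $\langle P\uplus\{\langle C,D\rangle\},A\rangle\longrightarrow\langle P\cup\{\langle C\,c,D\rangle\},A\rangle$ if $C\wedge D\models_{\mathcal Z} c$. Forget: $\langle P\uplus\{\langle C\,c,D\rangle\},A\rangle\longrightarrow\langle P\cup\{\langle C,D\rangle\},A\rangle$ if $C\wedge D\models_{\mathcal Z} c$. Propagate: $\langle P\uplus\{\langle C,D\rangle\},A\rangle\longrightarrow\langle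 P\cup\{\langle C,D\,d\rangle\},A\rangle$ if $d$ is a simple equality and $C\wedge D\models_{\mathcal Z} d$. Drop: $\langle P\uplus\{\langle C,D\rangle\},A\rangle\longrightarrow\langle P,A\rangle$ if $C\wedge D$ has no integer solution. Prune: $\langle P\uplus\{\langle C,D\rangle\},A\rangle\longrightarrow\langle P,A\rangle$ if $A\neq\mathrm{none}$ and $lb(\langle C,D\rangle)\ge obj(A)$. Retire: $\langle P\uplus\{\langle C,D\rangle\},A\rangle\longrightarrow\langle P,A'\rangle$ if $A'$ is a $T$-model of $C\wedge D\wedge I$, $obj(A')<obj(A)$, and $obj(A')\le obj(B)$ for every $T$-model $B$ of $C\wedge D\wedge I$. Unbounded: $\langle P\uplus\{\langle C,D\rangle\},A\rangle\longrightarrow\langle \emptyset,A'^{ -\infty}\rangle$ if $A'$ is a $T$-model of $C\wedge D\wedge I$, $obj(A')\le obj(A)$, and for every $k$ there is a $T$-model $B$ of $C\wedge D\wedge I$ with $obj(B)<k$. T-Learn: $\langle P\uplus\{\langle C,D\rangle\},A\rangle\longrightarrow\langle P\cup\{\langle C\,c,D\rangle\},A\rangle$ if there is a formula $F$ with $C\wedge D\models_{\mathcal Z} F$ and $F\wedge I\models_T c$. -}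

module Defs where

open import Data.Integer using (ℤ; _+_; _*_; 0ℤ; 1ℤ; -1ℤ) renaming (_≤_ to _≤ℤ_; _<_ to _<ℤ_)
open import Data.Nat using (ℕ) renaming (_<_ to _<ℕ_)
open import Data.List using (List; []; _∷_; _++_; map; length)
open import Data.List.Membership.Propositional using (_∈_; _∉_)
open import Data.List.Relation.Unary.All using (All)
open import Data.List.Relation.Unary.Any using (Any)
open import Data.List.Relation.Unary.AllPairs using (AllPairs)
open import Data.Product using (Σ; ∃; _×_; _,_; proj₁; proj₂)
open import Data.Empty using (⊥)
open import Function.Bundles using (_⇔_)
open import Relation.Nullary using (¬_)
open import Relation.Binary.PropositionalEquality using (_≡_)

data Rel : Set where
  lt le eq gt ge : Rel

record Constraint (V : Set) : Set where
  constructor mkC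
  field
    coeffs : List (ℤ × V)
    rel    : Rel
    rhs    : ℤ

Assignment : Set → Set
Assignment V = V → ℤ

evalL : {V : Set} → Assignment V → List (ℤ × V) → ℤ
evalL A [] = 0ℤ
evalL A ((c , v) ∷ xs) = c * A v + evalL A xs

holdsRel : Rel → ℤ → ℤ → Set
holdsRel lt x r = x <ℤ r
holdsRel le x r = x ≤ℤ r
holdsRel eq x r = x ≡ r
holdsRel gt x r = r <ℤ x
holdsRel ge x r = r ≤ℤ x

SatC : {V : Set} → Assignment V → Constraint V → Set
SatC A (mkC cs ρ r) = holdsRel ρ (evalL A cs) r

-- An integer linear formula: a finite set (conjunction) of constraints,
-- represented by a list considered up to membership (see _≈F_).
Formula : Set → Set
Formula V = List (Constraint V)

SatF : {V : Set} → Assignment V → Formula V → Set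
SatF A F = All (SatC A) F

data IsSimpleEq {V : Set} : Constraint V → Set where
  single : (v : V) (c : ℤ) → IsSimpleEq (mkC ((1ℤ , v) ∷ []) eq c)
  diff   : (vi vj : V) (c : ℤ) → IsSimpleEq (mkC ((1ℤ , vi) ∷ (-1ℤ , vj) ∷ []) eq c)

_≈F_ : {V : Set} → Formula V → Formula V → Set
F ≈F G = ∀ c → (c ∈ F) ⇔ (c ∈ G)

Subproblem : Set → Set
Subproblem V = Formula V × Formula V

_≈SP_ : {V : Set} → Subproblem V → Subproblem V → Set
(C , D) ≈SP (C' , D') = (C ≈F C') × (D ≈F D')

-- set of subproblems: list considered up to ≈SP-membership
SPSet : Set → Set
SPSet V = List (Subproblem V)

_∈P_ : {V : Set} → Subproblem V → SPSet V → Set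
s ∈P P = Any (s ≈SP_) P

_∉P_ : {V : Set} → Subproblem V → SPSet V → Set
s ∉P P = ¬ (s ∈P P)

_≈P_ : {V : Set} → SPSet V → SPSet V → Set
P ≈P Q = ∀ s → (s ∈P P) ⇔ (s ∈P Q)

SatSP : {V : Set} → Assignment V → Subproblem V → Set
SatSP A (C , D) = SatF A C × SatF A D

SatDisj : {V : Set} → Assignment V → SPSet V → Set
SatDisj A P = Any (SatSP A) P

_⊨Z_ : {V : Set} → (Assignment V → Set) → (Assignment V → Set) → Set
F ⊨Z G = ∀ A → F A → G A

data ℤ∞ : Set where
  -∞  : ℤ∞
  fin : ℤ → ℤ∞
  +∞  : ℤ∞

data _≤∞_ : ℤ∞ → ℤ∞ → Set where
  -∞≤     : ∀ {x} → -∞ ≤∞ x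
  ≤+∞     : ∀ {x} → x ≤∞ +∞
  fin≤fin : ∀ {a b} → a ≤ℤ b → fin a ≤∞ fin b

data _<∞_ : ℤ∞ → ℤ∞ → Set where
  -∞<fin  : ∀ {a} → -∞ <∞ fin a
  -∞<+∞   : -∞ <∞ +∞
  fin<+∞  : ∀ {a} → fin a <∞ +∞
  fin<fin : ∀ {a b} → a <ℤ b → fin a <∞ fin b

-- Abstract interface to the background theory T together with the
-- fixed set I of Σ-interface atoms of the instance.

record TheoryInterface (V : Set) : Set₁ where
  field
    -- formulas F usable in T-Learn, with their meaning over ℤ
    Fml    : Set
    ZHolds : Fml → Assignment V → Set
    -- F ∧ I ⊨_T c
    EntT   : Fml → Constraint V → Set
    -- A is T-consistent and A ⊨_{Z ∪ T} I
    TOK    : Assignment V → Set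

-- ILP Modulo T instance (C₀ , I , O); I is carried by TheoryInterface
record Instance (V : Set) : Set where
  field
    C₀ : Formula V
    O  : List (ℤ × V)

data AsgSt (V : Set) : Set where
  none  : AsgSt V
  asg   : Assignment V → AsgSt V
  asgInf : Assignment V → AsgSt V

State : Set → Set
State V = SPSet V × AsgSt V

module BC {V : Set} (Th : TheoryInterface V) (inst : Instance V)
          (lb : Subproblem V → ℤ∞) where
  open TheoryInterface Th
  open Instance inst

  objA : Assignment V → ℤ
  objA A = evalL A O

  obj : AsgSt V → ℤ∞
  obj none = +∞
  obj (asg A) = fin (objA A)
  obj (asgInf A) = -∞

  TModel : Assignment V → Subproblem V → Set
  TModel A s = TOK A × SatSP A s

  data _⟶_ : State V → State V → Set where
    branch : ∀ {P₀ P₁ P C D A} (Cs : List (Formula V)) →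
      P₀ ≈P ((C , D) ∷ P) → (C , D) ∉P P →
      1 <ℕ length Cs →
      (λ B → SatF B D) ⊨Z (λ B → SatF B C ⇔ Any (SatF B) Cs) →
      AllPairs (λ X Y → ¬ (X ≈F Y)) Cs →
      P₁ ≈P (P ++ map (λ Ci → (Ci , D)) Cs) →
      (P₀ , A) ⟶ (P₁ , A)
    learn : ∀ {P₀ P₁ P C D A} (c : Constraint V) →
      P₀ ≈P ((C , D) ∷ P) → (C , D) ∉P P →
      c ∉ C → (λ B → SatSP B (C , D)) ⊨Z (λ B → SatC B c) →
      P₁ ≈P ((c ∷ C , D) ∷ P) →
      (P₀ , A) ⟶ (P₁ , A)
    forget : ∀ {P₀ P₁ P C D A} (c : Constraint V) →
      P₀ ≈P ((c ∷ C , D) ∷ P) → (c ∷ C , D) ∉P P →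
      c ∉ C → (λ B → SatSP B (C , D)) ⊨Z (λ B → SatC B c) →
      P₁ ≈P ((C , D) ∷ P) →
      (P₀ , A) ⟶ (P₁ , A)
    propagate : ∀ {P₀ P₁ P C D A} (d : Constraint V) →
      P₀ ≈P ((C , D) ∷ P) → (C , D) ∉P P →
      IsSimpleEq d → d ∉ D → (λ B → SatSP B (C , D)) ⊨Z (λ B → SatC B d) →
      P₁ ≈P ((C , d ∷ D) ∷ P) →
      (P₀ , A) ⟶ (P₁ , A)
    drop : ∀ {P₀ P₁ P C D A} →
      P₀ ≈P ((C , D) ∷ P) → (C , D) ∉P P →
      ¬ (∃ λ B → SatSP B (C , D)) →
      P₁ ≈P P →
      (P₀ , A) ⟶ (P₁ , A)
    prune : ∀ {P₀ P₁ P C D A} →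
      P₀ ≈P ((C , D) ∷ P) → (C , D) ∉P P →
      ¬ (A ≡ none) → obj A ≤∞ lb (C , D) →
      P₁ ≈P P →
      (P₀ , A) ⟶ (P₁ , A)
    retire : ∀ {P₀ P₁ P C D A} (A' : Assignment V) →
      P₀ ≈P ((C , D) ∷ P) → (C , D) ∉P P →
      TModel A' (C , D) → fin (objA A') <∞ obj A →
      (∀ B → TModel B (C , D) → objA A' ≤ℤ objA B) →
      P₁ ≈P P →
      (P₀ , A) ⟶ (P₁ , asg A')
    unbounded : ∀ {P₀ P₁ P C D A} (A' : Assignment V) →
      P₀ ≈P ((C , D) ∷ P) → (C , D) ∉P P →
      TModel A' (C , D) → fin (objA A') ≤∞ obj A →
      (∀ (k : ℤ) → ∃ λ B → TModel B (C , D) × objA B <ℤ k) →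
      P₁ ≈P [] →
      (P₀ , A) ⟶ (P₁ , asgInf A')
    t-learn : ∀ {P₀ P₁ P C D A} (c : Constraint V) (F : Fml) →
      P₀ ≈P ((C , D) ∷ P) → (C , D) ∉P P →
      c ∉ C → (λ B → SatSP B (C , D)) ⊨Z ZHolds F → EntT F c →
      P₁ ≈P ((c ∷ C , D) ∷ P) →
      (P₀ , A) ⟶ (P₁ , A)

LbSound : {V : Set} → Instance V → (Subproblem V → ℤ∞) → Set
LbSound {V} inst lb = ∀ (s : Subproblem V) (A : Assignment V) →
  SatSP A s → lb s ≤∞ fin (evalL A (Instance.O inst))

LbResp : {V : Set} → (Subproblem V → ℤ∞) → Set
LbResp {V} lb = ∀ (s t : Subproblem V) → s ≈SP t → lb s ≡ lb t

-- Each rule of BC(T) removes one subproblem s from P and puts back a list R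
-- of subproblems each of which entails s: strengthenings of s (Branch, Learn,
-- T-Learn, Propagate), s weakened by a constraint it implies (Forget), or
-- nothing (Drop, Prune, Retire, Unbounded).  So a model of some member of the
-- new set models either s or an untouched member of the old set.
module Submission where

open import Defs
open import Data.Product using (_,_)
open import Data.Sum using (_⊎_; inj₁; inj₂)
open import Data.Empty using (⊥-elim)
open import Data.List using (List; []; _∷_; _++_; map)
open import Data.List.Membership.Propositional using (lose)
open import Data.List.Relation.Unary.All using (All; []; _∷_; tabulate; lookup; lookupAny)
open import Data.List.Relation.Unary.All.Properties using (map⁺)
open import Data.List.Relation.Unary.Any using (Any; here; there)
open import Data.List.Relation.Unary.Any.Properties using (++⁻; ++-comm; ¬Any[])
open import Function.Bundles using (_⇔_; mk⇔; Equivalence)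
open Equivalence using (to; from)
open import Function.Base using (id)

module _ {V : Set} where

  _⊨SP_ : Subproblem V → Subproblem V → Set
  s ⊨SP t = (λ B → SatSP B s) ⊨Z (λ B → SatSP B t)

  _⊆P_ : SPSet V → SPSet V → Set
  P ⊆P Q = ∀ s → s ∈P P → s ∈P Q

  ≈P⇒⊆P : {P Q : SPSet V} → P ≈P Q → P ⊆P Q
  ≈P⇒⊆P e s = to (e s)

  ≈P⇒⊇P : {P Q : SPSet V} → P ≈P Q → Q ⊆P P
  ≈P⇒⊇P e s = from (e s)

  SatF-resp-≈F : ∀ {B} {F G : Formula V} → F ≈F G → SatF B F → SatF B G
  SatF-resp-≈F e sat = tabulate (λ {c} c∈G → lookup sat (from (e c) c∈G))

  SatSP-resp-≈SP : ∀ {B} {s t : Subproblem V} → s ≈SP t → SatSP B s → SatSP B t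
  SatSP-resp-≈SP (eC , eD) (satC , satD) = SatF-resp-≈F eC satC , SatF-resp-≈F eD satD

  ≈SP-refl : (s : Subproblem V) → s ≈SP s
  ≈SP-refl s = (λ _ → mk⇔ id id)
             , (λ _ → mk⇔ id id)

  ∈P⇒SatDisj : ∀ {B s} (Q : SPSet V) → s ∈P Q → SatSP B s → SatDisj B Q
  ∈P⇒SatDisj (_ ∷ _) (here e) sat = here (SatSP-resp-≈SP e sat)
  ∈P⇒SatDisj (_ ∷ Q) (there s∈Q) sat = there (∈P⇒SatDisj Q s∈Q sat)

  SatDisj-mono : ∀ {B} {P Q : SPSet V} → P ⊆P Q → SatDisj B P → SatDisj B Q
  SatDisj-mono {P = p ∷ _} {Q} P⊆Q (here sat) = ∈P⇒SatDisj Q (P⊆Q p (here (≈SP-refl p))) sat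
  SatDisj-mono {P = _ ∷ _} P⊆Q (there sat) = SatDisj-mono (λ s m → P⊆Q s (there m)) sat

  strengthenC-⊨SP : ∀ c (C D : Formula V) → (c ∷ C , D) ⊨SP (C , D)
  strengthenC-⊨SP c C D B ((_ ∷ satC) , satD) = satC , satD

  strengthenD-⊨SP : ∀ d (C D : Formula V) → (C , d ∷ D) ⊨SP (C , D)
  strengthenD-⊨SP d C D B (satC , (_ ∷ satD)) = satC , satD

  implied-⊨SP : ∀ c (C D : Formula V) → (λ B → SatSP B (C , D)) ⊨Z (λ B → SatC B c) →
                (C , D) ⊨SP (c ∷ C , D)
  implied-⊨SP c C D ent B sat@(satC , satD) = ent B sat ∷ satC , satD

  split-⊨SP : ∀ (Cs : List (Formula V)) C D →
              (λ B → SatF B D) ⊨Z (λ B → SatF B C ⇔ Any (SatF B) Cs) →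
              All (_⊨SP (C , D)) (map (λ Ci → Ci , D) Cs)
  split-⊨SP Cs C D iff = map⁺ (tabulate λ Ci∈Cs B (satCi , satD) →
    from (iff B satD) (lose Ci∈Cs satCi) , satD)

  record Refinement (P₀ P₁ : SPSet V) : Set where
    constructor refinement
    field
      focus        : Subproblem V
      rest         : SPSet V
      replacements : SPSet V
      source       : (focus ∷ rest) ⊆P P₀
      target       : P₁ ⊆P (replacements ++ rest)
      sound        : All (_⊨SP focus) replacements

  Refinement⇒⊨ : {P₀ P₁ : SPSet V} → Refinement P₀ P₁ →
                 (λ B → SatDisj B P₁) ⊨Z (λ B → SatDisj B P₀)
  Refinement⇒⊨ r B sat₁ =
    SatDisj-mono source (split (++⁻ replacements (SatDisj-mono target sat₁)))
    where
    open Refinement r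
    split : SatDisj B replacements ⊎ SatDisj B rest → SatDisj B (focus ∷ rest)
    split (inj₁ satR) with lookupAny sound satR
    ... | ent , satr = here (ent B satr)
    split (inj₂ satRest) = there satRest

module _ {V : Set} (Th : TheoryInterface V) (inst : Instance V) (lb : Subproblem V → ℤ∞) where
  open BC Th inst lb

  ⟶⇒Refinement : ∀ {P₀ P₁ A A'} → (P₀ , A) ⟶ (P₁ , A') → Refinement P₀ P₁
  ⟶⇒Refinement (branch {P = P} {C} {D} Cs e₀ _ _ iff _ e₁) =
    refinement (C , D) P (map (λ Ci → Ci , D) Cs) (≈P⇒⊇P e₀)
      (λ s m → ++-comm P (map (λ Ci → Ci , D) Cs) (to (e₁ s) m)) (split-⊨SP Cs C D iff)
  ⟶⇒Refinement (learn {P = P} {C} {D} c e₀ _ _ _ e₁) =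
    refinement (C , D) P ((c ∷ C , D) ∷ []) (≈P⇒⊇P e₀) (≈P⇒⊆P e₁) (strengthenC-⊨SP c C D ∷ [])
  ⟶⇒Refinement (forget {P = P} {C} {D} c e₀ _ _ ent e₁) =
    refinement (c ∷ C , D) P ((C , D) ∷ []) (≈P⇒⊇P e₀) (≈P⇒⊆P e₁) (implied-⊨SP c C D ent ∷ [])
  ⟶⇒Refinement (propagate {P = P} {C} {D} d e₀ _ _ _ _ e₁) =
    refinement (C , D) P ((C , d ∷ D) ∷ []) (≈P⇒⊇P e₀) (≈P⇒⊆P e₁) (strengthenD-⊨SP d C D ∷ [])
  ⟶⇒Refinement (drop {P = P} {C} {D} e₀ _ _ e₁) =
    refinement (C , D) P [] (≈P⇒⊇P e₀) (≈P⇒⊆P e₁) []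
  ⟶⇒Refinement (prune {P = P} {C} {D} e₀ _ _ _ e₁) =
    refinement (C , D) P [] (≈P⇒⊇P e₀) (≈P⇒⊆P e₁) []
  ⟶⇒Refinement (retire {P = P} {C} {D} _ e₀ _ _ _ _ e₁) =
    refinement (C , D) P [] (≈P⇒⊇P e₀) (≈P⇒⊆P e₁) []
  ⟶⇒Refinement (unbounded {P = P} {C} {D} _ e₀ _ _ _ _ e₁) =
    refinement (C , D) P [] (≈P⇒⊇P e₀) (λ s m → ⊥-elim (¬Any[] (to (e₁ s) m))) []
  ⟶⇒Refinement (t-learn {P = P} {C} {D} c _ e₀ _ _ _ _ e₁) =
    refinement (C , D) P ((c ∷ C , D) ∷ []) (≈P⇒⊇P e₀) (≈P⇒⊆P e₁) (strengthenC-⊨SP c C D ∷ [])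

lemma5 : {V : Set} (Th : TheoryInterface V) (inst : Instance V)
         (lb : Subproblem V → ℤ∞) → LbSound inst lb → LbResp lb →
         (P P' : SPSet V) (A A' : AsgSt V) →
         BC._⟶_ Th inst lb (P , A) (P' , A') →
         (λ B → SatDisj B P') ⊨Z (λ B → SatDisj B P)
lemma5 Th inst lb _ _ _ _ _ _ step = Refinement⇒⊨ (⟶⇒Refinement Th inst lb step)
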